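{- Let $\Gamma$ be a Horn context. Then for every atom $r$ there exists a finitary term $N_r\in\overline{\lambda}^{gfp}_{\Sigma}$ with no free occurrences of fixpoint variables such that $[\![N_r]\!]=\mathcal{S}(\Gamma\Rightarrow r)$.
   Context: Formulas are built from atoms by implication $\supset$ (associating to the right). Horn formulas are $H::=p\mid p\supset H$ ($p$ an atom), i.e. formulas $q_1\supset\cdots\supset q_k\supset p$ with all $q_i$ atoms; a Horn context is a finite list of declarations $x:H$ with distinct variables and Horn formulas $H$. Böhm forests and elimination alternatives are the possibly infinite expressions generated coinductively by $N::=_{co}\lambda x^A.N\mid E_1+\cdots+E_n$, $E::=_{co}x\langle N_1,\dots,N_k\rangle$ ($n,k\ge0$); equality of Böhm forests is coinductive (bisimilarity) with sums of alternatives treated as sets (i.e. $+$ is associative, commutative, idempotent, with the empty sum $\mathbb{O}$ as neutral element). The solution space is defined corecursively by $\mathcal{S}(\Gamma\Rightarrow A\supset B)=\lambda x^A.\mathcal{S}(\Gamma,x:A\Rightarrow B)$ ($x$ fresh) and $\mathcal{S}(\Gamma\Rightarrow p)=\sum_{(y:B_1\supset\cdots\supset B_k\supset p)\in\Gamma}y\langle\mathcal{S}(\Gamma\Rightarrow B_1),\dots,\mathcal{S}(\Gamma\Rightarrow B_k)\rangle$ for $p$ an atom. The finitary calculus $\overline{\lambda}^{gfp}_{\Sigma}$ has (inductively defined) terms $N::=\lambda x^A.N\mid \mathrm{gfp}\,X.(E_1+\cdots+E_n)\mid X$ and elimination alternatives $E::=x\langle N_1,\dots,N_k\rangle$, where $X$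 ranges over a countably infinite set of fixpoint variables, bound by $\mathrm{gfp}$. An environment $\xi$ maps fixpoint variables to Böhm forests; the interpretation is defined by recursion: $[\![X]\!]_\xi=\xi(X)$; $[\![\lambda x^A.N]\!]_\xi=\lambda x^A.[\![N]\!]_\xi$; $[\![x\langle N_1,\dots,N_k\rangle]\!]_\xi=x\langle[\![N_1]\!]_\xi,\dots,[\![N_k]\!]_\xi\rangle$; $[\![\mathrm{gfp}\,X.\sum_iE_i]\!]_\xi$ is the unique Böhm forest $N$ satisfying $N=\sum_i[\![E_i]\!]_{\xi[X\mapsto N]}$. For a term without free fixpoint variables the interpretation does not depend on $\xi$ and is written $[\![N]\!]$. -}

module Defs where

open import Data.Nat using (ℕ; suc; _⊔_) renaming (_≟_ to _≟ℕ_)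
open import Data.List using (List; []; _∷_; map; foldr)
open import Data.List.Relation.Unary.All using (All)
open import Data.List.Relation.Unary.Any using (Any)
open import Data.List.Relation.Binary.Pointwise using (Pointwise)
open import Data.List.Relation.Unary.Unique.Propositional using (Unique)
open import Data.List.Membership.Propositional using (_∈_)
open import Data.Maybe using (Maybe; just; nothing)
open import Data.Product using (Σ; _×_; _,_; proj₁; proj₂)
open import Data.Sum using (_⊎_; inj₁; inj₂)
open import Data.Unit using (⊤; tt)
open import Data.Empty using (⊥)
open import Relation.Nullary using (yes; no)
open import Relation.Binary.PropositionalEquality using (_≡_)

Atom : Set
Atom = ℕ

Var : Set
Var = ℕ

FVar : Set
FVar = ℕ

infixr 5 _⊃_
data Form : Set where
  at  : Atom → Form
  _⊃_ : Form → Form → Form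

IsHorn : Form → Set
IsHorn (at p)         = ⊤
IsHorn (at q ⊃ H)     = IsHorn H
IsHorn ((A ⊃ B) ⊃ C)  = ⊥

Ctx : Set
Ctx = List (Var × Form)

HornCtx : Ctx → Set
HornCtx Γ = All (λ d → IsHorn (proj₂ d)) Γ × Unique (map proj₁ Γ)

-- X   |   (x₁⟨X,…,X⟩ + ⋯ + xₙ⟨X,…,X⟩)
-- i.e. a forest is a state space St, a one-step unfolding 'step', and a
-- start state.  Equality of forests (coinductive equality = bisimilarity)
-- is then the existence of a bisimulation relating the start states.

data AltF (X : Set) : Set where
  app : Var → List X → AltF X

data NodeF (X : Set) : Set where
  lam : Var → Form → X → NodeF X
  sum : List (AltF X) → NodeF X

mapNodeF : {X Y : Set} → (X → Y) → NodeF X → NodeF Y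
mapAltF  : {X Y : Set} → (X → Y) → AltF X → AltF Y
mapAltsF : {X Y : Set} → (X → Y) → List (AltF X) → List (AltF Y)
mapNodeF f (lam x A s) = lam x A (f s)
mapNodeF f (sum Es)    = sum (mapAltsF f Es)
mapAltF f (app x ss)   = app x (map f ss)
mapAltsF f []          = []
mapAltsF f (E ∷ Es)    = mapAltF f E ∷ mapAltsF f Es

record Forest : Set₁ where
  field
    St    : Set
    step  : St → NodeF St
    start : St

open Forest public

𝕆 : Forest
𝕆 = record { St = ⊤ ; step = λ _ → sum [] ; start = tt }

-- Lifting of a relation R ⊆ X × Y along NodeF, with sums of alternatives
-- treated as sets: each alternative on one side is matched by a related
-- alternative on the other side.
data AltRel {X Y : Set} (R : X → Y → Set) : AltF X → AltF Y → Set where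
  app≈ : ∀ {x ss ts} → Pointwise R ss ts → AltRel R (app x ss) (app x ts)

data NodeRel {X Y : Set} (R : X → Y → Set) : NodeF X → NodeF Y → Set where
  lam≈ : ∀ {x A s t} → R s t → NodeRel R (lam x A s) (lam x A t)
  sum≈ : ∀ {Es Fs} →
         All (λ E → Any (λ F → AltRel R E F) Fs) Es →
         All (λ F → Any (λ E → AltRel R E F) Es) Fs →
         NodeRel R (sum Es) (sum Fs)

infix 4 _≈_
record _≈_ (M N : Forest) : Set₁ where
  field
    Rel      : St M → St N → Set
    Rel-start : Rel (start M) (start N)
    Rel-step  : ∀ s t → Rel s t → NodeRel Rel (step M s) (step N t)

args : Form → List Form
args (at p)  = []
args (A ⊃ B) = A ∷ args B

target : Form → Atom
target (at p)  = p
target (A ⊃ B) = target B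

fresh : Ctx → Var
fresh Γ = suc (foldr (λ d m → proj₁ d ⊔ m) 0 Γ)

Sequent : Set
Sequent = Ctx × Form

S-alts : Ctx → Ctx → Atom → List (AltF Sequent)
S-alts Γ [] p = []
S-alts Γ ((y , B) ∷ Δ) p with target B ≟ℕ p
... | yes _ = app y (map (λ C → (Γ , C)) (args B)) ∷ S-alts Γ Δ p
... | no  _ = S-alts Γ Δ p

S-step : Sequent → NodeF Sequent
S-step (Γ , (A ⊃ B)) = lam (fresh Γ) A (((fresh Γ , A) ∷ Γ) , B)
S-step (Γ , at p)    = sum (S-alts Γ Γ p)

S : Ctx → Form → Forest
S Γ A = record { St = Sequent ; step = S-step ; start = (Γ , A) }

mutual
  data Term : Set where
    fv  : FVar → Term
    lam : Var → Form → Term → Term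
    gfp : FVar → List ETerm → Term

  data ETerm : Set where
    app : Var → List Term → ETerm

mutual
  ClosedUnder : List FVar → Term → Set
  ClosedUnder bs (fv X)      = X ∈ bs
  ClosedUnder bs (lam x A N) = ClosedUnder bs N
  ClosedUnder bs (gfp X Es)  = ClosedUnderEs (X ∷ bs) Es

  ClosedUnderEs : List FVar → List ETerm → Set
  ClosedUnderEs bs []              = ⊤
  ClosedUnderEs bs (app x Ns ∷ Es) = ClosedUnderNs bs Ns × ClosedUnderEs bs Es

  ClosedUnderNs : List FVar → List Term → Set
  ClosedUnderNs bs []       = ⊤
  ClosedUnderNs bs (N ∷ Ns) = ClosedUnder bs N × ClosedUnderNs bs Ns

Closed : Term → Set
Closed = ClosedUnder []

-- Fixpoint
-- variables bound by an enclosing gfp are recorded syntactically in a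
-- closure environment ρ (X ↦ body Es together with the closure
-- environment at the gfp); ⟦ gfp X.Es ⟧ is obtained by unfolding, i.e.
-- it is the forest N with N = Σᵢ ⟦Eᵢ⟧_{ξ[X ↦ N]}.

Env : Set₁
Env = FVar → Forest

data CEnv : Set where
  ε    : CEnv
  bind : FVar → List ETerm → CEnv → CEnv → CEnv   -- X ↦ (Es , ρ'), rest

lookupC : FVar → CEnv → Maybe (List ETerm × CEnv)
lookupC X ε = nothing
lookupC X (bind Y Es ρ' ρ) with X ≟ℕ Y
... | yes _ = just (Es , ρ')
... | no  _ = lookupC X ρ

IState : Env → Set
IState ξ = (Term × CEnv) ⊎ Σ FVar (λ X → St (ξ X))

module _ (ξ : Env) where

  I-alts : List ETerm → CEnv → List (AltF (IState ξ))
  I-alts [] ρ              = []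
  I-alts (app x Ns ∷ Es) ρ = app x (map (λ N → inj₁ (N , ρ)) Ns) ∷ I-alts Es ρ

  I-fv : FVar → Maybe (List ETerm × CEnv) → NodeF (IState ξ)
  I-fv X (just (Es , ρ')) = sum (I-alts Es (bind X Es ρ' ρ'))
  I-fv X nothing          = mapNodeF (λ s → inj₂ (X , s)) (step (ξ X) (start (ξ X)))

  I-step : IState ξ → NodeF (IState ξ)
  I-step (inj₁ (fv X , ρ))      = I-fv X (lookupC X ρ)
  I-step (inj₁ (lam x A N , ρ)) = lam x A (inj₁ (N , ρ))
  I-step (inj₁ (gfp X Es , ρ))  = sum (I-alts Es (bind X Es ρ ρ))
  I-step (inj₂ (X , s))         = mapNodeF (λ s' → inj₂ (X , s')) (step (ξ X) s)

⟦_⟧_ : Term → Env → Forest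
⟦ N ⟧ ξ = record { St = IState ξ ; step = I-step ξ ; start = inj₁ (N , ε) }

-- Over a Horn context no λ is ever introduced, so every sequent reachable from
-- Γ ⇒ r is of the form Γ ⇒ q for an atom q: the solution space has one state per
-- atom.  N_r unfolds r into gfp r.(…), using the atom q itself as the fixpoint
-- variable standing for Γ ⇒ q, and refers back by the variable q whenever Γ ⇒ q is already
-- being unfolded on the current branch.  Each branch binds distinct target atoms
-- of Γ, so the unfolding is finite.  Reading a term together with its closure
-- environment as a state, "N represents Γ ⇒ q" is then a bisimulation between
-- ⟦ N_r ⟧ and S(Γ ⇒ r).
module Submission where

open import Defs
open import Data.Product using (Σ; ∃; _×_; _,_; proj₂)
open import Data.Nat using (_<_) renaming (_≟_ to _≟ℕ_)
open import Data.Nat.Induction using (<-wellFounded)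
open import Data.List using (List; []; _∷_; map; filter; length)
open import Data.List.Properties using (filter-notAll)
open import Data.List.Relation.Unary.All using (All; []; _∷_)
import Data.List.Relation.Unary.All as All
open import Data.List.Relation.Unary.Any using (Any; here; there)
import Data.List.Relation.Unary.Any as Any
open import Data.List.Relation.Binary.Pointwise as Pointwise using (Pointwise; []; _∷_)
open import Data.List.Membership.Propositional using (_∈_; _∉_)
open import Data.List.Membership.Propositional.Properties using (∈-filter⁺)
open import Data.List.Membership.DecPropositional _≟ℕ_ using (_∈?_)
open import Data.Sum using (inj₁; inj₂)
open import Data.Unit using (tt)
open import Data.Empty using (⊥; ⊥-elim)
open import Function using (_∘_; id)
open import Induction.WellFounded using (Acc; acc)
open import Relation.Nullary using (yes; no; ¬?)
open import Relation.Unary using (Decidable)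
open import Relation.Binary.PropositionalEquality using (_≡_; _≢_; refl; sym; subst)

Pointwise⇒All-Any : {X Y : Set} {R : X → Y → Set} {xs : List X} {ys : List Y} →
  Pointwise R xs ys → All (λ x → Any (R x) ys) xs
Pointwise⇒All-Any []       = []
Pointwise⇒All-Any (r ∷ rs) = here r ∷ All.map there (Pointwise⇒All-Any rs)

Pointwise⇒sum≈ : {X Y : Set} {R : X → Y → Set} {Es : List (AltF X)} {Fs : List (AltF Y)} →
  Pointwise (AltRel R) Es Fs → NodeRel R (sum Es) (sum Fs)
Pointwise⇒sum≈ rs = sum≈ (Pointwise⇒All-Any rs) (Pointwise⇒All-Any (Pointwise.symmetric id rs))

dom : CEnv → List FVar
dom ε              = []
dom (bind X _ _ ρ) = X ∷ dom ρ

targets : Ctx → List Atom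
targets = map (target ∘ proj₂)

module _ (Γ : Ctx) where

  mutual
    data Represents (bs : List FVar) : Term → Sequent → Set where
      fv  : ∀ {q} → q ∈ bs → Represents bs (fv q) (Γ , at q)
      gfp : ∀ {q Es} → Pointwise (RepresentsAlt (q ∷ bs)) Es (S-alts Γ Γ q) →
            Represents bs (gfp q Es) (Γ , at q)

    data RepresentsAlt (bs : List FVar) : ETerm → AltF Sequent → Set where
      app : ∀ {x Ns ss} → Pointwise (Represents bs) Ns ss → RepresentsAlt bs (app x Ns) (app x ss)

  mutual
    represents⇒closed : ∀ {bs N t} → Represents bs N t → ClosedUnder bs N
    represents⇒closed (fv q∈bs)  = q∈bs
    represents⇒closed (gfp alts) = alts⇒closed alts

    alts⇒closed : ∀ {bs Es Fs} → Pointwise (RepresentsAlt bs) Es Fs → ClosedUnderEs bs Es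
    alts⇒closed []             = tt
    alts⇒closed (app a ∷ alts) = args⇒closed a , alts⇒closed alts

    args⇒closed : ∀ {bs Ns ss} → Pointwise (Represents bs) Ns ss → ClosedUnderNs bs Ns
    args⇒closed []       = tt
    args⇒closed (r ∷ rs) = represents⇒closed r , args⇒closed rs

  data RepresentsEnv : CEnv → Set where
    ε    : RepresentsEnv ε
    bind : ∀ {X Es ρ' ρ} → Represents (dom ρ') (gfp X Es) (Γ , at X) →
           RepresentsEnv ρ' → RepresentsEnv ρ → RepresentsEnv (bind X Es ρ' ρ)

  module _ (ξ : Env) where

    -- States of ⟦ N ⟧ ξ in the right summand are never reached from a closed term.
    Bisim : IState ξ → Sequent → Set
    Bisim (inj₁ (N , ρ)) t = RepresentsEnv ρ × Represents (dom ρ) N t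
    Bisim (inj₂ _)       t = ⊥

    Bisim-args : ∀ {ρ Ns ss} → RepresentsEnv ρ → Pointwise (Represents (dom ρ)) Ns ss →
      Pointwise Bisim (map (λ N → inj₁ (N , ρ)) Ns) ss
    Bisim-args env []       = []
    Bisim-args env (r ∷ rs) = (env , r) ∷ Bisim-args env rs

    Bisim-alts : ∀ {ρ Es Fs} → RepresentsEnv ρ → Pointwise (RepresentsAlt (dom ρ)) Es Fs →
      Pointwise (AltRel Bisim) (I-alts ξ Es ρ) Fs
    Bisim-alts env []                = []
    Bisim-alts env (app args ∷ alts) = app≈ (Bisim-args env args) ∷ Bisim-alts env alts

    unfold-gfp : ∀ {ρ q Es} → RepresentsEnv ρ → Represents (dom ρ) (gfp q Es) (Γ , at q) →
      NodeRel Bisim (sum (I-alts ξ Es (bind q Es ρ ρ))) (sum (S-alts Γ Γ q))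
    unfold-gfp env r@(gfp alts) = Pointwise⇒sum≈ (Bisim-alts (bind r env env) alts)

    unfold-fv : ∀ {ρ q} → RepresentsEnv ρ → q ∈ dom ρ →
      NodeRel Bisim (I-fv ξ q (lookupC q ρ)) (sum (S-alts Γ Γ q))
    unfold-fv {bind X _ _ _} {q} (bind r env' env) q∈ with q ≟ℕ X | q∈
    ... | yes refl | _       = unfold-gfp env' r
    ... | no q≢X   | here e  = ⊥-elim (q≢X e)
    ... | no _     | there m = unfold-fv env m

    Bisim-step : ∀ s t → Bisim s t → NodeRel Bisim (I-step ξ s) (S-step t)
    Bisim-step (inj₁ (fv q , ρ))     _ (env , fv q∈)      = unfold-fv env q∈
    Bisim-step (inj₁ (gfp q Es , ρ)) _ (env , r@(gfp _)) = unfold-gfp env r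

    represents⇒≈ : ∀ {N r} → Represents [] N (Γ , at r) → ⟦ N ⟧ ξ ≈ S Γ (at r)
    represents⇒≈ r = record { Rel = Bisim ; Rel-start = ε , r ; Rel-step = Bisim-step }

  S-alts-non-target : ∀ Δ {q} → q ∉ targets Δ → S-alts Γ Δ q ≡ []
  S-alts-non-target []            q∉ = refl
  S-alts-non-target ((_ , B) ∷ Δ) {q} q∉ with target B ≟ℕ q
  ... | yes e = ⊥-elim (q∉ (here (sym e)))
  ... | no _  = S-alts-non-target Δ (q∉ ∘ there)

  module _ {bs : List FVar} (rec : ∀ q → ∃ λ N → Represents bs N (Γ , at q)) where

    represent-args : ∀ B → IsHorn B → ∃ λ Ns → Pointwise (Represents bs) Ns (map (Γ ,_) (args B))
    represent-args (at p)     _ = [] , []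
    represent-args (at q ⊃ H) h =
      let N , r = rec q ; Ns , rs = represent-args H h in N ∷ Ns , r ∷ rs

    represent-alts : ∀ Δ → All (IsHorn ∘ proj₂) Δ → ∀ q →
      ∃ λ Es → Pointwise (RepresentsAlt bs) Es (S-alts Γ Δ q)
    represent-alts []            []       q = [] , []
    represent-alts ((y , B) ∷ Δ) (h ∷ hs) q with target B ≟ℕ q
    ... | yes _ = let Ns , rs = represent-args B h ; Es , alts = represent-alts Δ hs q
                  in app y Ns ∷ Es , app rs ∷ alts
    ... | no _  = represent-alts Δ hs q

  -- rem over-approximates the target atoms not yet bound; binding q removes it.
  represent : All (IsHorn ∘ proj₂) Γ → (rem : List Atom) → Acc _<_ (length rem) →
    (bs : List FVar) → (∀ {a} → a ∈ targets Γ → a ∉ bs → a ∈ rem) →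
    ∀ q → ∃ λ N → Represents bs N (Γ , at q)
  represent horn rem (acc shorter) bs cover q with q ∈? bs | q ∈? rem
  ... | yes q∈bs | _ = fv q , fv q∈bs
  ... | no q∉bs | no q∉rem =
    gfp q [] , gfp (subst (Pointwise _ []) (sym (S-alts-non-target Γ λ q∈ → q∉rem (cover q∈ q∉bs))) [])
  ... | no _ | yes q∈rem =
    let Es , alts = represent-alts (represent horn rem' (shorter rem'<rem) (q ∷ bs) cover') Γ horn q
    in gfp q Es , gfp alts
    where
    ≢q? : Decidable (_≢ q)
    ≢q? a = ¬? (a ≟ℕ q)

    rem' : List Atom
    rem' = filter ≢q? rem

    rem'<rem : length rem' < length rem
    rem'<rem = filter-notAll ≢q? rem (Any.map (λ q≡a a≢q → a≢q (sym q≡a)) q∈rem)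

    cover' : ∀ {a} → a ∈ targets Γ → a ∉ q ∷ bs → a ∈ rem'
    cover' a∈ a∉ = ∈-filter⁺ ≢q? (cover a∈ (a∉ ∘ there)) (a∉ ∘ here)

theorem16 : (Γ : Ctx) → HornCtx Γ → (r : Atom) →
    Σ Term (λ N → Closed N × ((ξ : Env) → ⟦ N ⟧ ξ ≈ S Γ (at r)))
theorem16 Γ (horn , _) r =
  let N , rep = represent Γ horn (targets Γ) (<-wellFounded _) [] (λ a∈ _ → a∈) r
  in N , represents⇒closed Γ rep , λ ξ → represents⇒≈ Γ ξ rep
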